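{- Let $s$ be a step sequence over a g-comtrace alphabet $(E,sim,ser,inl)$. Then $\lhd_s\in ext\big(G^{\{s\}}\big)$.
   Context: Relations: for $R$ on $X$, $R^{ -1}$ inverse, $R^*=\bigcup_{i\ge0}R^i$ ($R^0=\mathrm{id}_X$), $R\circ S=\{(x,y):\exists z.\,xRz\wedge zSy\}$, $R^{\mathrm{sym}}=R\cup R^{ -1}$, $R^{\Cap}=R\cap R^{ -1}$, $R^C=(X\times X)\setminus R$. A g-comtrace alphabet is $(E,sim,ser,inl)$ with $E$ finite, $sim,inl\subseteq E\times E$ irreflexive and symmetric, $ser\subseteq sim$, $sim\cap inl=\emptyset$. Steps $\mathbb{S}$: nonempty $A\subseteq E$ with $(a,b)\in sim$ for all distinct $a,b\in A$; step sequences: elements of $\mathbb{S}^*$. For $s=A_1\dots A_k$: $\overline{A_i}=\{e^{(m+1)}:e\in A_i\}$ where $m$ is the number of $j<i$ with $e\in A_j$; $\Sigma_s=\bigcup_i\overline{A_i}$; $l(e^{(j)})=e$; $pos_s(\alpha)=i$ iff $\alpha\in\overline{A_i}$; $\alpha\lhd_s\beta$ iff $pos_s(\alpha)<pos_s(\beta)$; $\alpha\lhd_s^\frown\beta$ iff $\alpha\ne\beta\wedge pos_s(\alpha)\le pos_s(\beta)$. Closures: $(X,R_1,R_2)^\lozenge=(X,\prec_{R_1,R_2},\sqsubset_{R_1,R_2})$ with $\prec_{R_1,R_2}=(R_1\cup R_2)^*\circ R_1\circ(R_1\cup R_2)^*$, $\sqsubset_{R_1,R_2}=(R_1\cup R_2)^*\setminus\mathrm{id}_X$;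 for $R_3=R_1\cap R_2^*$, $(X,R_1,R_2)^{\bowtie}=(X,(\prec_{R_3,R_2})^{\mathrm{sym}}\cup R_1,\sqsubset_{R_3,R_2})$. On $\Sigma_s$: $\alpha<\!\!>_s\beta$ iff $(l(\alpha),l(\beta))\in inl$; $\alpha\sqsubset_s\beta$ iff $\alpha\lhd_s^\frown\beta$ and $(l(\beta),l(\alpha))\notin ser\cup inl$; $\alpha\prec_s\beta$ iff $\alpha\lhd_s\beta$ and one of: (i) $(l(\alpha),l(\beta))\notin ser\cup inl$; (ii) $(\alpha,\beta)\in<\!\!>_s\cap((\sqsubset_s^*)^{\Cap}\circ(<\!\!>_s)^C\circ(\sqsubset_s^*)^{\Cap})$; (iii) $(l(\alpha),l(\beta))\in ser$ and there are $\delta,\gamma\in\Sigma_s$ with $\delta\lhd_s\gamma$, $(l(\delta),l(\gamma))\notin ser$, $\alpha\sqsubset_s^*\delta\sqsubset_s^*\beta$, $\alpha\sqsubset_s^*\gamma\sqsubset_s^*\beta$. $G^{\{s\}}=(\Sigma_s,\prec_s\cup<\!\!>_s,\prec_s\cup\sqsubset_s)^{\bowtie}$. A stratified order on $X$ is an irreflexive transitive $\lhd$ for which $a\simeq b\iff(a=b\vee(\neg a\lhd b\wedge\neg b\lhd a))$ is an equivalence; $\alpha\lhd^\frown\beta$ iff $\alpha\ne\beta\wedge\neg(\beta\lhd\alpha)$. For $G=(X,<\!\!>,\sqsubset)$, $ext(G)$ is the set of stratified orders $\lhd$ on $X$ with $\alpha<\!\!>\beta\Rightarrow(\alpha\lhd\beta\vee\beta\lhd\alpha)$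 and $\alpha\sqsubset\beta\Rightarrow\alpha\lhd^\frown\beta$. -}

module Defs where

open import Data.Bool using (Bool; true; false; T; if_then_else_)
open import Data.Nat using (ℕ; zero; suc; _<_; _≤_)
open import Data.Fin using (Fin; toℕ)
open import Data.Fin.Subset using (Subset; _∈_; Nonempty)
open import Data.Fin.Subset.Properties using (_∈?_)
open import Data.List using (List; []; _∷_; length; lookup; take)
open import Data.Product using (Σ; ∃; ∃₂; _×_; _,_; proj₁; proj₂)
open import Data.Sum using (_⊎_)
open import Relation.Nullary using (¬_; does)
open import Relation.Binary.PropositionalEquality using (_≡_; _≢_)
open import Relation.Binary.Structures using (IsEquivalence)
open import Relation.Binary.Construct.Closure.ReflexiveTransitive using (Star)

Rel : Set → Set₁
Rel X = X → X → Set

module _ {X : Set} where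

  _⁻¹ʳ : Rel X → Rel X
  (R ⁻¹ʳ) x y = R y x

  _⋆ : Rel X → Rel X
  R ⋆ = Star R

  _∘ʳ_ : Rel X → Rel X → Rel X
  (R ∘ʳ S) x y = ∃ λ z → R x z × S z y

  _∪ʳ_ : Rel X → Rel X → Rel X
  (R ∪ʳ S) x y = R x y ⊎ S x y

  _∩ʳ_ : Rel X → Rel X → Rel X
  (R ∩ʳ S) x y = R x y × S x y

  _ˢʸᵐ : Rel X → Rel X
  R ˢʸᵐ = R ∪ʳ (R ⁻¹ʳ)

  _ᶜᵃᵖ : Rel X → Rel X
  R ᶜᵃᵖ = R ∩ʳ (R ⁻¹ʳ)

  _ᶜ : Rel X → Rel X
  (R ᶜ) x y = ¬ R x y

  _∖id : Rel X → Rel X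
  (R ∖id) x y = R x y × x ≢ y

  -- Relational structures (X, R₁, R₂) (X is the implicit carrier)

  record Triple : Set₁ where
    constructor ⟨_,_⟩
    field
      fst : Rel X
      snd : Rel X

  ≺[_,_] : Rel X → Rel X → Rel X
  ≺[ R₁ , R₂ ] = ((R₁ ∪ʳ R₂) ⋆) ∘ʳ (R₁ ∘ʳ ((R₁ ∪ʳ R₂) ⋆))

  ⊏[_,_] : Rel X → Rel X → Rel X
  ⊏[ R₁ , R₂ ] = ((R₁ ∪ʳ R₂) ⋆) ∖id

  ◇ : Rel X → Rel X → Triple
  ◇ R₁ R₂ = ⟨ ≺[ R₁ , R₂ ] , ⊏[ R₁ , R₂ ] ⟩

  ⋈ : Rel X → Rel X → Triple
  ⋈ R₁ R₂ = ⟨ ((Triple.fst (◇ R₃ R₂)) ˢʸᵐ) ∪ʳ R₁ , Triple.snd (◇ R₃ R₂) ⟩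
    where
    R₃ : Rel X
    R₃ = R₁ ∩ʳ (R₂ ⋆)

  incomparable : Rel X → Rel X
  incomparable ◁ a b = a ≡ b ⊎ (¬ ◁ a b × ¬ ◁ b a)

  record StratifiedOrder (◁ : Rel X) : Set where
    field
      irreflexive : ∀ x → ¬ ◁ x x
      transitive  : ∀ {x y z} → ◁ x y → ◁ y z → ◁ x z
      ≃-equivalence : IsEquivalence (incomparable ◁)

  _⌢ : Rel X → Rel X
  (◁ ⌢) α β = α ≢ β × ¬ ◁ β α

  ext : Triple → Rel X → Set
  ext G ◁ = StratifiedOrder ◁
          × (∀ α β → Triple.fst G α β → ◁ α β ⊎ ◁ β α)
          × (∀ α β → Triple.snd G α β → (◁ ⌢) α β)

-- g-comtrace alphabets; E = Fin n, relations given by their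
-- characteristic (Bool-valued) functions: (a,b) ∈ R iff T (R a b).

record GComtraceAlphabet : Set where
  field
    n   : ℕ
    sim : Fin n → Fin n → Bool
    ser : Fin n → Fin n → Bool
    inl : Fin n → Fin n → Bool
    sim-irrefl : ∀ a → ¬ T (sim a a)
    sim-sym    : ∀ a b → T (sim a b) → T (sim b a)
    inl-irrefl : ∀ a → ¬ T (inl a a)
    inl-sym    : ∀ a b → T (inl a b) → T (inl b a)
    ser⊆sim    : ∀ a b → T (ser a b) → T (sim a b)
    sim∩inl≡∅  : ∀ a b → T (sim a b) → ¬ T (inl a b)

module _ (Γ : GComtraceAlphabet) where
  open GComtraceAlphabet Γ

  E : Set
  E = Fin n

  IsStep : Subset n → Set
  IsStep A = Nonempty A × (∀ a b → a ∈ A → b ∈ A → a ≢ b → T (sim a b))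

  Step : Set
  Step = Σ (Subset n) IsStep

  StepSeq : Set
  StepSeq = List Step

  countOcc : E → List Step → ℕ
  countOcc e [] = 0
  countOcc e ((A , _) ∷ s) =
    if does (e ∈? A) then suc (countOcc e s) else countOcc e s

  -- event names e^(k), encoded as (e , k)
  EventName : Set
  EventName = E × ℕ

  -- α ∈ \overline{A_i}  (steps indexed from 0): α = e^(m+1) with e ∈ A_i
  -- and m the number of j < i with e ∈ A_j
  InBar : (s : StepSeq) → Fin (length s) → EventName → Set
  InBar s i (e , k) = e ∈ proj₁ (lookup s i) × k ≡ suc (countOcc e (take (toℕ i) s))

  InΣ : StepSeq → EventName → Set
  InΣ s α = ∃ λ i → InBar s i α

  Σₛ : StepSeq → Set
  Σₛ s = Σ EventName (InΣ s)

  module _ (s : StepSeq) where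

    lab : Σₛ s → E
    lab ((e , _) , _) = e

    pos : Σₛ s → ℕ
    pos (_ , (i , _)) = toℕ i

    ◁ₛ : Rel (Σₛ s)
    ◁ₛ α β = pos α < pos β

    ◁⌢ₛ : Rel (Σₛ s)
    ◁⌢ₛ α β = α ≢ β × pos α ≤ pos β

    notSerInl : E → E → Set
    notSerInl a b = ¬ (T (ser a b) ⊎ T (inl a b))

    <>ₛ : Rel (Σₛ s)
    <>ₛ α β = T (inl (lab α) (lab β))

    ⊏ₛ : Rel (Σₛ s)
    ⊏ₛ α β = ◁⌢ₛ α β × notSerInl (lab β) (lab α)

    condII : Rel (Σₛ s)
    condII = <>ₛ ∩ʳ (((⊏ₛ ⋆) ᶜᵃᵖ) ∘ʳ ((<>ₛ ᶜ) ∘ʳ ((⊏ₛ ⋆) ᶜᵃᵖ)))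

    condIII : Rel (Σₛ s)
    condIII α β = T (ser (lab α) (lab β))
      × ∃₂ λ δ γ → ◁ₛ δ γ × ¬ T (ser (lab δ) (lab γ))
                 × (⊏ₛ ⋆) α δ × (⊏ₛ ⋆) δ β
                 × (⊏ₛ ⋆) α γ × (⊏ₛ ⋆) γ β

    ≺ₛ : Rel (Σₛ s)
    ≺ₛ α β = ◁ₛ α β × (notSerInl (lab α) (lab β) ⊎ condII α β ⊎ condIII α β)

    G : Triple
    G = ⋈ (≺ₛ ∪ʳ <>ₛ) (≺ₛ ∪ʳ ⊏ₛ)

module Submission where

-- The order ◁ₛ compares events by the index of the step they
-- occur in, i.e. it is the strict order induced by the rank function pos.
-- The whole proposition is an instance of a general fact about the ⋈ closure:
-- if every R₁-edge joins elements of different rank and no R₂-edge lowers the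
-- rank, then "lower rank" is a stratified extension of (X, R₁, R₂)^⋈.
-- Indeed R₃ = R₁ ∩ R₂* then strictly raises the rank, hence so does ≺[R₃,R₂],
-- while ⊏[R₃,R₂] never lowers it.

open import Defs
open import Data.Nat using (ℕ; _<_; _≤_)
open import Data.Nat.Properties
  using (≤-refl; ≤-trans; ≤-antisym; <⇒≤; <⇒≢; <⇒≱; ≮⇒≥; ≤∧≢⇒<; <-irrefl; <-trans;
         ≤-<-trans; <-≤-trans; <-cmp)
open import Data.Fin.Properties using (toℕ-injective)
open import Data.List using (lookup)
open import Data.Product using (_,_; proj₂)
open import Data.Sum using (_⊎_; inj₁; inj₂)
open import Data.Empty using (⊥-elim)
open import Relation.Binary.PropositionalEquality using (_≡_; _≢_; refl; sym; trans)
open import Relation.Binary.Definitions using (tri<; tri≈; tri>)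
open import Relation.Binary.Construct.Closure.ReflexiveTransitive using (fold)

module RankOrder {X : Set} (rank : X → ℕ) where

  _◁_ : Rel X
  a ◁ b = rank a < rank b

  incomparable⇒same-rank : ∀ {a b} → incomparable _◁_ a b → rank a ≡ rank b
  incomparable⇒same-rank (inj₁ refl)        = refl
  incomparable⇒same-rank (inj₂ (a⋪b , b⋪a)) = ≤-antisym (≮⇒≥ b⋪a) (≮⇒≥ a⋪b)

  same-rank⇒incomparable : ∀ {a b} → rank a ≡ rank b → incomparable _◁_ a b
  same-rank⇒incomparable eq = inj₂ (<-irrefl eq , <-irrefl (sym eq))

  rank-stratified : StratifiedOrder _◁_
  rank-stratified = record
    { irreflexive   = λ _ → <-irrefl refl
    ; transitive    = <-trans
    ; ≃-equivalence = record
      { refl  = inj₁ refl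
      ; sym   = λ a≃b → same-rank⇒incomparable (sym (incomparable⇒same-rank a≃b))
      ; trans = λ a≃b b≃c → same-rank⇒incomparable
                  (trans (incomparable⇒same-rank a≃b) (incomparable⇒same-rank b≃c))
      }
    }

  different-rank⇒comparable : ∀ {a b} → rank a ≢ rank b → a ◁ b ⊎ b ◁ a
  different-rank⇒comparable {a} {b} ne with <-cmp (rank a) (rank b)
  ... | tri< a◁b _  _   = inj₁ a◁b
  ... | tri≈ _   eq _   = ⊥-elim (ne eq)
  ... | tri> _   _  b◁a = inj₂ b◁a

  RankMonotone : Rel X → Set
  RankMonotone R = ∀ {a b} → R a b → rank a ≤ rank b

  RankSeparating : Rel X → Set
  RankSeparating R = ∀ {a b} → R a b → rank a ≢ rank b

  star-monotone : ∀ {R} → RankMonotone R → RankMonotone (R ⋆)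
  star-monotone mono = fold (λ a b → rank a ≤ rank b) (λ r q → ≤-trans (mono r) q) ≤-refl

  ⋈-rank-ext : ∀ {R₁ R₂} → RankSeparating R₁ → RankMonotone R₂ → ext (⋈ R₁ R₂) _◁_
  ⋈-rank-ext {R₁} {R₂} sep mono = rank-stratified , fst-comparable , snd-weakly-below
    where
    R₃ : Rel X
    R₃ = R₁ ∩ʳ (R₂ ⋆)

    -- R₃-edges change the rank and, via R₂*, cannot lower it.
    R₃-raises : ∀ {a b} → R₃ a b → a ◁ b
    R₃-raises (r₁ , r₂⋆) = ≤∧≢⇒< (star-monotone mono r₂⋆) (sep r₁)

    R₃∪R₂-monotone : RankMonotone (R₃ ∪ʳ R₂)
    R₃∪R₂-monotone (inj₁ r₃) = <⇒≤ (R₃-raises r₃)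
    R₃∪R₂-monotone (inj₂ r₂) = mono r₂

    -- A (R₃ ∪ R₂)-path containing an R₃-edge strictly raises the rank.
    ≺-raises : ∀ {a b} → ≺[ R₃ , R₂ ] a b → a ◁ b
    ≺-raises (_ , before , (_ , r₃ , after)) =
      ≤-<-trans (star-monotone R₃∪R₂-monotone before)
        (<-≤-trans (R₃-raises r₃) (star-monotone R₃∪R₂-monotone after))

    fst-comparable : ∀ α β → Triple.fst (⋈ R₁ R₂) α β → α ◁ β ⊎ β ◁ α
    fst-comparable _ _ (inj₁ (inj₁ α≺β)) = inj₁ (≺-raises α≺β)
    fst-comparable _ _ (inj₁ (inj₂ β≺α)) = inj₂ (≺-raises β≺α)
    fst-comparable _ _ (inj₂ r₁)         = different-rank⇒comparable (sep r₁)

    snd-weakly-below : ∀ α β → Triple.snd (⋈ R₁ R₂) α β → (_◁_ ⌢) α β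
    snd-weakly-below _ _ (path , α≢β) =
      α≢β , λ β◁α → <⇒≱ β◁α (star-monotone R₃∪R₂-monotone path)

module StepSequenceRanks (Γ : GComtraceAlphabet) (s : StepSeq Γ) where
  open GComtraceAlphabet Γ
  open RankOrder (pos Γ s) using (RankMonotone; RankSeparating)

  -- Events of one step have sim-related (or equal) labels, and sim ∩ inl = ∅,
  -- so inl-related events occur in different steps.
  inl-separates : RankSeparating (<>ₛ Γ s)
  inl-separates {(e , _) , (i , e∈Aᵢ , _)} {(f , _) , (j , f∈Aⱼ , _)} inl-ef same-pos
    with toℕ-injective same-pos
  ... | refl = sim∩inl≡∅ e f (proj₂ (proj₂ (lookup s i)) e f e∈Aᵢ f∈Aⱼ e≢f) inl-ef
    where
    e≢f : e ≢ f
    e≢f refl = inl-irrefl e inl-ef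

  ≺∪<>-separates : RankSeparating (≺ₛ Γ s ∪ʳ <>ₛ Γ s)
  ≺∪<>-separates (inj₁ (α◁β , _))    = <⇒≢ α◁β
  ≺∪<>-separates {α} {β} (inj₂ α<>β) = inl-separates {α} {β} α<>β

  ≺∪⊏-monotone : RankMonotone (≺ₛ Γ s ∪ʳ ⊏ₛ Γ s)
  ≺∪⊏-monotone (inj₁ (α◁β , _))       = <⇒≤ α◁β
  ≺∪⊏-monotone (inj₂ ((_ , α≤β) , _)) = α≤β

proposition11p5 : (Γ : GComtraceAlphabet) (s : StepSeq Γ) → ext (G Γ s) (◁ₛ Γ s)
proposition11p5 Γ s = RankOrder.⋈-rank-ext (pos Γ s) ≺∪<>-separates ≺∪⊏-monotone
  where open StepSequenceRanks Γ s
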